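{- Define $h(n)$ by $$\sum_{n=0}^{\infty}h(n)q^n=\frac{(-q;q)_\infty}{(q;q)_\infty}(q^4;q^4)_\infty(-q^4;q^4)_\infty^2 \left(=\sum_{n=0}^{\infty}\frac{(-q;q)_{2n}q^n}{(q;q)_{2n+1}}\right).$$ Then $h(n)$ equals the number of partitions of $n$ into parts such that no part is $\equiv 0\pmod 8$, parts $\equiv 2,6\pmod 8$ come in one colour, and parts $\equiv 1,3,4,5,7\pmod 8$ come in two colours.
   Context: $(A;q)_n=\prod_{k=0}^{n-1}(1-Aq^k)$, $(A;q)_\infty=\prod_{k\ge0}(1-Aq^k)$, $|q|<1$. A part "coming in $t$ colours" means each part of that kind may be chosen in one of $t$ distinguishable colours. -}

module Defs where

open import Data.Nat as ℕ using (ℕ; zero; suc; _∸_; _<_; _≤_; _%_)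
open import Data.Nat.Divisibility using (_∣?_)
open import Data.Integer as ℤ using (ℤ; +_; -_)
open import Data.Product using (_×_; _,_; proj₁)
open import Data.Sum using (_⊎_)
open import Data.List using (List; map)
open import Data.Nat.ListAction using (sum)
open import Data.List.Relation.Unary.All using (All)
open import Data.List.Relation.Unary.Linked using (Linked)
open import Relation.Binary.PropositionalEquality using (_≡_)
open import Relation.Nullary.Decidable using (⌊_⌋)
open import Data.Bool using (if_then_else_)

FPS : Set
FPS = ℕ → ℤ

Σ≤ : (ℕ → ℤ) → ℕ → ℤ
Σ≤ t zero    = t zero
Σ≤ t (suc n) = Σ≤ t n ℤ.+ t (suc n)

_⊛_ : FPS → FPS → FPS
(f ⊛ g) n = Σ≤ (λ i → f i ℤ.* g (n ∸ i)) n
infixl 7 _⊛_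

𝟙 : FPS
𝟙 zero    = + 1
𝟙 (suc _) = + 0

1+_q^_ : ℤ → ℕ → FPS
(1+ a q^ k) n = 𝟙 n ℤ.+ (if ⌊ n ℕ.≟ k ⌋ then a else + 0)

-- the series 1/(1 - q^k) = Σ_j q^{jk}, for k ≥ 1
geo : ℕ → FPS
geo k n = if ⌊ k ∣? n ⌋ then + 1 else + 0

prodTo : (ℕ → FPS) → ℕ → FPS
prodTo F zero    = 𝟙
prodTo F (suc m) = prodTo F m ⊛ F (suc m)

-- infinite product ∏_{k ≥ 1} F k, for factors with F k ≡ 1 mod q^k:
-- the coefficient of q^n is that of the finite product over k ≤ n.
prodInf : (ℕ → FPS) → FPS
prodInf F n = prodTo F n n

negQQ : FPS
negQQ = prodInf (λ k → 1+ (+ 1) q^ k)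

invQQ : FPS
invQQ = prodInf geo

Q4Q4 : FPS
Q4Q4 = prodInf (λ k → 1+ (- + 1) q^ (4 ℕ.* k))

negQ4Q4 : FPS
negQ4Q4 = prodInf (λ k → 1+ (+ 1) q^ (4 ℕ.* k))

h : ℕ → ℤ
h = negQQ ⊛ invQQ ⊛ Q4Q4 ⊛ (negQ4Q4 ⊛ negQ4Q4)

colours : ℕ → ℕ
colours k with k % 8
... | 0 = 0
... | 2 = 1
... | 6 = 1
... | _ = 2

-- a coloured part is (size , colour)
-- lexicographic "≥" on coloured parts
_⊒_ : ℕ × ℕ → ℕ × ℕ → Set
(a , c) ⊒ (b , d) = (b < a) ⊎ (b ≡ a × d ≤ c)

-- p is a coloured partition of n: a list of coloured parts in
-- (lexicographically) non-increasing order (canonical representative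
-- of the multiset), every part positive with colour < colours(part),
-- and the sizes summing to n.
IsColPartition : ℕ → List (ℕ × ℕ) → Set
IsColPartition n p =
  All (λ { (k , c) → 1 ≤ k × c < colours k }) p
  × Linked _⊒_ p
  × sum (map proj₁ p) ≡ n

module Submission where

-- Since (-q;q)∞ = (q²;q²)∞/(q;q)∞ and (-q⁴;q⁴)∞ = (q⁸;q⁸)∞/(q⁴;q⁴)∞, the series of h is the
-- eta quotient (q²;q²)∞ (q⁸;q⁸)∞² / ((q;q)∞² (q⁴;q⁴)∞) = ∏ⱼ (1 - qʲ)^-(e j), where
-- e j = 2 - [2∣j] + [4∣j] - 2[8∣j]; inspecting j mod 8 gives e j = colours j.
-- So Σ h(n) qⁿ is a product of one geometric series 1/(1 - qᵏ) per coloured part (k, c),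
-- whose coefficient of qⁿ counts the coloured partitions of n. Every identity is proved
-- coefficientwise up to degree n, where an infinite product whose k-th factor is 1 modulo qᵏ
-- may be replaced by its factors with k ≤ n.

open import Defs
open import Data.Nat as ℕ using (ℕ; zero; suc; _∸_; _≤_; _<_; z≤n; s≤s; NonZero)
import Data.Nat.Properties as ℕP
open import Data.Integer as ℤ using (ℤ; +_; -_)
import Data.Integer.Properties as ℤP
open import Data.Integer.Tactic.RingSolver using (solve-∀)
open import Data.Product using (_×_; _,_; proj₁; proj₂; ∃-syntax; uncurry)
import Data.Product.Properties as ×P
open import Data.Sum using (_⊎_; inj₁; inj₂)
open import Data.Empty using (⊥-elim)
open import Data.List using (List; []; _∷_; _++_; map; foldr; length; applyDownFrom)
open import Data.List.Properties using (length-++; length-map)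
open import Data.Nat.ListAction using (sum)
open import Data.List.Relation.Unary.All as All using (All; []; _∷_)
open import Data.List.Relation.Unary.Any using (here; there)
open import Data.List.Relation.Unary.AllPairs using (AllPairs; []; _∷_)
import Data.List.Relation.Unary.AllPairs.Properties as AllPairs
open import Data.List.Relation.Unary.Linked using (Linked; []; [-]; _∷_)
open import Data.List.Relation.Unary.Linked.Properties using (Linked⇒All)
open import Data.List.Relation.Unary.Unique.Propositional using (Unique)
import Data.List.Relation.Unary.Unique.Propositional.Properties as Unique
open import Data.List.Membership.Propositional using (_∈_)
open import Data.List.Membership.Propositional.Properties
  using (∈-map⁺; ∈-map⁻; ∈-++⁺ˡ; ∈-++⁺ʳ; ∈-++⁻; ∈-applyDownFrom⁺; ∈-applyDownFrom⁻)
open import Data.Product.Relation.Binary.Lex.Strict using (×-transitive)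
open import Function using (_∘_)
open import Data.Bool using (true; false; if_then_else_)
open import Relation.Nullary.Decidable using (Dec; yes; no; ⌊_⌋; does-⇔; dec-true; dec-false; isYes≗does)
open import Data.Nat.Divisibility
  using (_∣_; divides; _∣?_; ∣-refl; ∣m+n∣m⇒∣n; ∣m∣n⇒∣m+n; >⇒∤; m∣m*n; %-presˡ-∣; ∣n∣m%n⇒∣m)
open import Data.Nat.DivMod using (_%_; m%n<n)
open import Relation.Nullary using (¬_)
open import Function.Bundles using (_⇔_; mk⇔)
open import Function.Construct.Composition using (_⇔-∘_)
open import Relation.Binary.PropositionalEquality
  using (_≡_; _≢_; refl; sym; trans; cong; cong₂; subst; _≗_; isEquivalence; resp₂; module ≡-Reasoning)
open import Algebra.Bundles using (CommutativeMonoid)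
import Algebra.Properties.CommutativeMonoid.Mult
open import Level using (0ℓ)
open import Relation.Binary.Bundles using (Setoid)
import Relation.Binary.Reasoning.Setoid as SetoidReasoning

⌊⌋-⇔ : ∀ {A B : Set} → A ⇔ B → (a? : Dec A) (b? : Dec B) → ⌊ a? ⌋ ≡ ⌊ b? ⌋
⌊⌋-⇔ A⇔B a? b? = trans (isYes≗does a?) (trans (does-⇔ A⇔B a? b?) (sym (isYes≗does b?)))

⌊⌋-true : ∀ {A : Set} (a? : Dec A) → A → ⌊ a? ⌋ ≡ true
⌊⌋-true a? a = trans (isYes≗does a?) (dec-true a? a)

⌊⌋-false : ∀ {A : Set} (a? : Dec A) → ¬ A → ⌊ a? ⌋ ≡ false
⌊⌋-false a? ¬a = trans (isYes≗does a?) (dec-false a? ¬a)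

-- Power series

_≈[_]_ : FPS → ℕ → FPS → Set
f ≈[ n ] g = ∀ m → m ≤ n → f m ≡ g m

_⊕_ : FPS → FPS → FPS
(f ⊕ g) n = f n ℤ.+ g n

_·_ : ℤ → FPS → FPS
(c · f) n = c ℤ.* f n

infixl 6 _⊕_
infixr 8 _·_

Σ≤-cong : ∀ {t u} n → (∀ i → i ≤ n → t i ≡ u i) → Σ≤ t n ≡ Σ≤ u n
Σ≤-cong zero    t≡u = t≡u 0 z≤n
Σ≤-cong (suc n) t≡u =
  cong₂ ℤ._+_ (Σ≤-cong n (λ i i≤n → t≡u i (ℕP.m≤n⇒m≤1+n i≤n))) (t≡u (suc n) ℕP.≤-refl)

Σ≤-unfoldˡ : ∀ t n → Σ≤ t (suc n) ≡ t 0 ℤ.+ Σ≤ (t ∘ suc) n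
Σ≤-unfoldˡ t zero    = refl
Σ≤-unfoldˡ t (suc n) =
  trans (cong (ℤ._+ t (suc (suc n))) (Σ≤-unfoldˡ t n)) (ℤP.+-assoc (t 0) _ _)

Σ≤-+ : ∀ t u n → Σ≤ (λ i → t i ℤ.+ u i) n ≡ Σ≤ t n ℤ.+ Σ≤ u n
Σ≤-+ t u zero    = refl
Σ≤-+ t u (suc n) rewrite Σ≤-+ t u n =
  interchange (Σ≤ t n) (Σ≤ u n) (t (suc n)) (u (suc n))
  where
  interchange : ∀ a b c d → (a ℤ.+ b) ℤ.+ (c ℤ.+ d) ≡ (a ℤ.+ c) ℤ.+ (b ℤ.+ d)
  interchange = solve-∀

Σ≤-* : ∀ c t n → Σ≤ (λ i → c ℤ.* t i) n ≡ c ℤ.* Σ≤ t n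
Σ≤-* c t zero    = refl
Σ≤-* c t (suc n) rewrite Σ≤-* c t n = sym (ℤP.*-distribˡ-+ c (Σ≤ t n) (t (suc n)))

⊛-unfoldˡ : ∀ f g n → (f ⊛ g) (suc n) ≡ f 0 ℤ.* g (suc n) ℤ.+ ((f ∘ suc) ⊛ g) n
⊛-unfoldˡ f g n = Σ≤-unfoldˡ (λ i → f i ℤ.* g (suc n ∸ i)) n

⊛-unfoldʳ : ∀ f g n → (f ⊛ g) (suc n) ≡ (f ⊛ (g ∘ suc)) n ℤ.+ f (suc n) ℤ.* g 0
⊛-unfoldʳ f g n =
  cong₂ ℤ._+_ (Σ≤-cong n (λ i i≤n → cong (λ k → f i ℤ.* g k) (ℕP.+-∸-assoc 1 i≤n)))
              (cong (λ k → f (suc n) ℤ.* g k) (ℕP.n∸n≡0 n))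

⊛-cong-≈[] : ∀ {f f′ g g′} n → f ≈[ n ] f′ → g ≈[ n ] g′ → (f ⊛ g) ≈[ n ] (f′ ⊛ g′)
⊛-cong-≈[] n f≈f′ g≈g′ m m≤n = Σ≤-cong m λ i i≤m →
  cong₂ ℤ._*_ (f≈f′ i (ℕP.≤-trans i≤m m≤n)) (g≈g′ (m ∸ i) (ℕP.≤-trans (ℕP.m∸n≤m m i) m≤n))

⊛-cong : ∀ {f f′ g g′} → f ≗ f′ → g ≗ g′ → (f ⊛ g) ≗ (f′ ⊛ g′)
⊛-cong f≗f′ g≗g′ n = ⊛-cong-≈[] n (λ m _ → f≗f′ m) (λ m _ → g≗g′ m) n ℕP.≤-refl

⊛-congˡ : ∀ f {g g′} → g ≗ g′ → (f ⊛ g) ≗ (f ⊛ g′)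
⊛-congˡ f = ⊛-cong {f} {f} (λ _ → refl)

⊛-congʳ : ∀ g {f f′} → f ≗ f′ → (f ⊛ g) ≗ (f′ ⊛ g)
⊛-congʳ g f≗f′ = ⊛-cong {g = g} {g} f≗f′ (λ _ → refl)

⊛-distribʳ-⊕ : ∀ f g h → ((f ⊕ g) ⊛ h) ≗ (f ⊛ h ⊕ g ⊛ h)
⊛-distribʳ-⊕ f g h n = trans (Σ≤-cong n (λ i _ → ℤP.*-distribʳ-+ (h (n ∸ i)) (f i) (g i)))
                              (Σ≤-+ (λ i → f i ℤ.* h (n ∸ i)) (λ i → g i ℤ.* h (n ∸ i)) n)

·-⊛-assoc : ∀ c f g → ((c · f) ⊛ g) ≗ c · (f ⊛ g)
·-⊛-assoc c f g n = trans (Σ≤-cong n (λ i _ → ℤP.*-assoc c (f i) (g (n ∸ i))))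
                          (Σ≤-* c (λ i → f i ℤ.* g (n ∸ i)) n)

⊛-comm : ∀ f g → (f ⊛ g) ≗ (g ⊛ f)
⊛-comm f g zero    = ℤP.*-comm (f 0) (g 0)
⊛-comm f g (suc n) = begin
  (f ⊛ g) (suc n)                            ≡⟨ ⊛-unfoldˡ f g n ⟩
  f 0 ℤ.* g (suc n) ℤ.+ ((f ∘ suc) ⊛ g) n    ≡⟨ cong (λ x → f 0 ℤ.* g (suc n) ℤ.+ x) (⊛-comm (f ∘ suc) g n) ⟩
  f 0 ℤ.* g (suc n) ℤ.+ (g ⊛ (f ∘ suc)) n    ≡⟨ swap (f 0) (g (suc n)) _ ⟩
  (g ⊛ (f ∘ suc)) n ℤ.+ g (suc n) ℤ.* f 0    ≡⟨ ⊛-unfoldʳ g f n ⟨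
  (g ⊛ f) (suc n)                            ∎
  where
  open ≡-Reasoning
  swap : ∀ a b c → a ℤ.* b ℤ.+ c ≡ c ℤ.+ b ℤ.* a
  swap = solve-∀

⊛-assoc : ∀ f g h → ((f ⊛ g) ⊛ h) ≗ (f ⊛ (g ⊛ h))
⊛-assoc f g h zero    = ℤP.*-assoc (f 0) (g 0) (h 0)
⊛-assoc f g h (suc n) = begin
  ((f ⊛ g) ⊛ h) (suc n)
    ≡⟨ ⊛-unfoldˡ (f ⊛ g) h n ⟩
  f 0 ℤ.* g 0 ℤ.* h (suc n) ℤ.+ (((f ⊛ g) ∘ suc) ⊛ h) n
    ≡⟨ cong (λ x → f 0 ℤ.* g 0 ℤ.* h (suc n) ℤ.+ x) (begin
      (((f ⊛ g) ∘ suc) ⊛ h) n                        ≡⟨ ⊛-congʳ h (⊛-unfoldˡ f g) n ⟩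
      ((f 0 · (g ∘ suc) ⊕ (f ∘ suc) ⊛ g) ⊛ h) n      ≡⟨ ⊛-distribʳ-⊕ (f 0 · (g ∘ suc)) ((f ∘ suc) ⊛ g) h n ⟩
      ((f 0 · (g ∘ suc)) ⊛ h) n ℤ.+ (((f ∘ suc) ⊛ g) ⊛ h) n
        ≡⟨ cong₂ ℤ._+_ (·-⊛-assoc (f 0) (g ∘ suc) h n) (⊛-assoc (f ∘ suc) g h n) ⟩
      f 0 ℤ.* ((g ∘ suc) ⊛ h) n ℤ.+ ((f ∘ suc) ⊛ (g ⊛ h)) n ∎) ⟩
  f 0 ℤ.* g 0 ℤ.* h (suc n) ℤ.+ (f 0 ℤ.* ((g ∘ suc) ⊛ h) n ℤ.+ ((f ∘ suc) ⊛ (g ⊛ h)) n)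
    ≡⟨ factor (f 0) (g 0) (h (suc n)) _ _ ⟩
  f 0 ℤ.* (g 0 ℤ.* h (suc n) ℤ.+ ((g ∘ suc) ⊛ h) n) ℤ.+ ((f ∘ suc) ⊛ (g ⊛ h)) n
    ≡⟨ cong (λ x → f 0 ℤ.* x ℤ.+ ((f ∘ suc) ⊛ (g ⊛ h)) n) (⊛-unfoldˡ g h n) ⟨
  f 0 ℤ.* (g ⊛ h) (suc n) ℤ.+ ((f ∘ suc) ⊛ (g ⊛ h)) n
    ≡⟨ ⊛-unfoldˡ f (g ⊛ h) n ⟨
  (f ⊛ (g ⊛ h)) (suc n) ∎
  where
  open ≡-Reasoning
  factor : ∀ a b c d e → a ℤ.* b ℤ.* c ℤ.+ (a ℤ.* d ℤ.+ e) ≡ a ℤ.* (b ℤ.* c ℤ.+ d) ℤ.+ e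
  factor = solve-∀

⊛-identityˡ : ∀ f → (𝟙 ⊛ f) ≗ f
⊛-identityˡ f zero    = ℤP.*-identityˡ (f 0)
⊛-identityˡ f (suc n) = begin
  (𝟙 ⊛ f) (suc n)                                ≡⟨ ⊛-unfoldˡ 𝟙 f n ⟩
  + 1 ℤ.* f (suc n) ℤ.+ ((𝟙 ∘ suc) ⊛ f) n        ≡⟨ cong₂ ℤ._+_ (ℤP.*-identityˡ (f (suc n))) 0⊛f≡0 ⟩
  f (suc n) ℤ.+ + 0                               ≡⟨ ℤP.+-identityʳ (f (suc n)) ⟩
  f (suc n)                                       ∎
  where
  open ≡-Reasoning
  0⊛f≡0 : ((𝟙 ∘ suc) ⊛ f) n ≡ + 0
  0⊛f≡0 = trans (⊛-congʳ f (λ _ → sym (ℤP.*-zeroˡ (+ 0))) n) (·-⊛-assoc (+ 0) (𝟙 ∘ suc) f n)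

⊛-identityʳ : ∀ f → (f ⊛ 𝟙) ≗ f
⊛-identityʳ f n = trans (⊛-comm f 𝟙 n) (⊛-identityˡ f n)

⊛-commutativeMonoid : CommutativeMonoid 0ℓ 0ℓ
⊛-commutativeMonoid = record
  { Carrier = FPS
  ; _≈_ = _≗_
  ; _∙_ = _⊛_
  ; ε = 𝟙
  ; isCommutativeMonoid = record
    { isMonoid = record
      { isSemigroup = record
        { isMagma = record
          { isEquivalence = record
            { refl = λ _ → refl ; sym = λ p n → sym (p n) ; trans = λ p q n → trans (p n) (q n) }
          ; ∙-cong = ⊛-cong }
        ; assoc = ⊛-assoc }
      ; identity = ⊛-identityˡ , ⊛-identityʳ }
    ; comm = ⊛-comm } }

open CommutativeMonoid ⊛-commutativeMonoid using () renaming (setoid to ≗-setoid)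
open import Algebra.Properties.CommutativeSemigroup
  (CommutativeMonoid.commutativeSemigroup ⊛-commutativeMonoid) using (interchange)
module Power = Algebra.Properties.CommutativeMonoid.Mult ⊛-commutativeMonoid
module ≗-Reasoning = SetoidReasoning ≗-setoid

_^_ : FPS → ℕ → FPS
f ^ e = e Power.× f

infixr 9 _^_

𝟙^≗𝟙 : ∀ e → 𝟙 ^ e ≗ 𝟙
𝟙^≗𝟙 zero    _ = refl
𝟙^≗𝟙 (suc e) n = trans (⊛-congˡ 𝟙 (𝟙^≗𝟙 e) n) (⊛-identityˡ 𝟙 n)

-- Shifts, binomials and geometric series

-- Serves both as multiplication by qᵏ on series and on the lists of partitions enumerated
-- below, so that counting commutes with it (shift-map).
shift : {A : Set} → A → ℕ → (ℕ → A) → ℕ → A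
shift z zero    g         = g
shift z (suc k) g zero    = z
shift z (suc k) g (suc m) = shift z k g m

shift-+ : ∀ {A : Set} (z : A) k g m → shift z k g (k ℕ.+ m) ≡ g m
shift-+ z zero    g m = refl
shift-+ z (suc k) g m = shift-+ z k g m

shift-< : ∀ {A : Set} (z : A) k g {m} → m < k → shift z k g m ≡ z
shift-< z (suc k) g {zero}  _         = refl
shift-< z (suc k) g {suc m} (s≤s m<k) = shift-< z k g m<k

shift-≥ : ∀ {A : Set} (z : A) k g {m} → k ≤ m → shift z k g m ≡ g (m ∸ k)
shift-≥ z k g {m} k≤m = trans (cong (shift z k g) (sym (ℕP.m+[n∸m]≡n k≤m))) (shift-+ z k g (m ∸ k))

shift-cong : ∀ {A : Set} (z : A) k {g g′ n} → (∀ m → k ℕ.+ m ≡ n → g m ≡ g′ m) →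
             shift z k g n ≡ shift z k g′ n
shift-cong z zero    {n = n}     g≡g′ = g≡g′ n refl
shift-cong z (suc k) {n = zero}  g≡g′ = refl
shift-cong z (suc k) {n = suc n} g≡g′ = shift-cong z k (λ m k+m≡n → g≡g′ m (cong suc k+m≡n))

shift-map : ∀ {A B : Set} (φ : A → B) z k g n → φ (shift z k g n) ≡ shift (φ z) k (φ ∘ g) n
shift-map φ z zero    g n       = refl
shift-map φ z (suc k) g zero    = refl
shift-map φ z (suc k) g (suc n) = shift-map φ z k g n

shift-cases : ∀ {A : Set} (z : A) k g n → shift z k g n ≡ z ⊎ ∃[ m ] (k ℕ.+ m ≡ n × shift z k g n ≡ g m)
shift-cases z zero    g n       = inj₂ (n , refl , refl)
shift-cases z (suc k) g zero    = inj₁ refl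
shift-cases z (suc k) g (suc n) with shift-cases z k g n
... | inj₁ eq               = inj₁ eq
... | inj₂ (m , k+m≡n , eq) = inj₂ (m , cong suc k+m≡n , eq)

∈-shift⁻ : ∀ {A : Set} {x : A} {k g n} → x ∈ shift [] k g n → ∃[ m ] (k ℕ.+ m ≡ n × x ∈ g m)
∈-shift⁻ {k = k} {g} {n} x∈ with shift-cases [] k g n
... | inj₁ eq                 with () ← subst (_ ∈_) eq x∈
... | inj₂ (m , k+m≡n , eq)   = m , k+m≡n , subst (_ ∈_) eq x∈

∈-shift⁺ : ∀ {A : Set} {x : A} {k g m} → x ∈ g m → x ∈ shift [] k g (k ℕ.+ m)
∈-shift⁺ {k = k} {g} {m} x∈ = subst (_ ∈_) (sym (shift-+ [] k g m)) x∈

shift-Unique : ∀ {A : Set} k (g : ℕ → List A) n → (∀ m → Unique (g m)) → Unique (shift [] k g n)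
shift-Unique k g n g-unique with shift-cases [] k g n
... | inj₁ eq             = subst Unique (sym eq) []
... | inj₂ (m , _ , eq)   = subst Unique (sym eq) (g-unique m)

q^_*_ : ℕ → FPS → FPS
q^ k * f = shift (+ 0) k f

infixr 8 q^_*_

q^*-⊛ : ∀ k f g → ((q^ k * f) ⊛ g) ≗ q^ k * (f ⊛ g)
q^*-⊛ zero    f g n       = refl
q^*-⊛ (suc k) f g zero    = ℤP.*-zeroˡ (g 0)
q^*-⊛ (suc k) f g (suc n) = begin
  ((q^ suc k * f) ⊛ g) (suc n)                   ≡⟨ ⊛-unfoldˡ (q^ suc k * f) g n ⟩
  + 0 ℤ.* g (suc n) ℤ.+ ((q^ k * f) ⊛ g) n      ≡⟨ cong₂ ℤ._+_ (ℤP.*-zeroˡ (g (suc n))) (q^*-⊛ k f g n) ⟩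
  + 0 ℤ.+ (q^ k * (f ⊛ g)) n                     ≡⟨ ℤP.+-identityˡ _ ⟩
  (q^ suc k * (f ⊛ g)) (suc n)                   ∎
  where open ≡-Reasoning

1+-as-⊕ : ∀ a k → 1+ a q^ k ≗ 𝟙 ⊕ a · (q^ k * 𝟙)
1+-as-⊕ a k n = cong (ℤ._+_ (𝟙 n)) (coefficient k n)
  where
  coefficient : ∀ k n → (if ⌊ n ℕ.≟ k ⌋ then a else + 0) ≡ a ℤ.* (q^ k * 𝟙) n
  coefficient zero    zero    = sym (ℤP.*-identityʳ a)
  coefficient zero    (suc n) = sym (ℤP.*-zeroʳ a)
  coefficient (suc k) zero    = sym (ℤP.*-zeroʳ a)
  coefficient (suc k) (suc n) =
    trans (cong (if_then a else + 0) (⌊⌋-⇔ (mk⇔ ℕP.suc-injective (cong suc)) (suc n ℕ.≟ suc k) (n ℕ.≟ k)))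
          (coefficient k n)

1+-⊛ : ∀ a k f → ((1+ a q^ k) ⊛ f) ≗ f ⊕ a · (q^ k * f)
1+-⊛ a k f n = begin
  ((1+ a q^ k) ⊛ f) n                           ≡⟨ ⊛-congʳ f (1+-as-⊕ a k) n ⟩
  ((𝟙 ⊕ a · (q^ k * 𝟙)) ⊛ f) n                  ≡⟨ ⊛-distribʳ-⊕ 𝟙 (a · (q^ k * 𝟙)) f n ⟩
  (𝟙 ⊛ f) n ℤ.+ ((a · (q^ k * 𝟙)) ⊛ f) n       ≡⟨ cong₂ ℤ._+_ (⊛-identityˡ f n) (·-⊛-assoc a (q^ k * 𝟙) f n) ⟩
  f n ℤ.+ a ℤ.* ((q^ k * 𝟙) ⊛ f) n             ≡⟨ cong (λ x → f n ℤ.+ a ℤ.* x) (q^*-⊛ k 𝟙 f n) ⟩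
  f n ℤ.+ a ℤ.* (q^ k * (𝟙 ⊛ f)) n
    ≡⟨ cong (λ x → f n ℤ.+ a ℤ.* x) (shift-cong (+ 0) k (λ m _ → ⊛-identityˡ f m)) ⟩
  f n ℤ.+ a ℤ.* (q^ k * f) n                   ∎
  where open ≡-Reasoning

q^*-1+ : ∀ k a j → q^ k * (1+ a q^ j) ≗ q^ k * 𝟙 ⊕ a · (q^ (k ℕ.+ j) * 𝟙)
q^*-1+ zero    a j n       = 1+-as-⊕ a j n
q^*-1+ (suc k) a j zero    = sym (trans (ℤP.+-identityˡ _) (ℤP.*-zeroʳ a))
q^*-1+ (suc k) a j (suc n) = q^*-1+ k a j n

1+q^_ : ℕ → FPS
1+q^ k = 1+ + 1 q^ k

1-q^_ : ℕ → FPS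
1-q^ k = 1+ - + 1 q^ k

1+q^-⊛-1-q^ : ∀ k → (1+q^ k ⊛ 1-q^ k) ≗ 1-q^ (2 ℕ.* k)
1+q^-⊛-1-q^ k n = begin
  (1+q^ k ⊛ 1-q^ k) n
    ≡⟨ 1+-⊛ (+ 1) k (1-q^ k) n ⟩
  (1-q^ k) n ℤ.+ + 1 ℤ.* (q^ k * 1-q^ k) n
    ≡⟨ cong₂ (λ x y → x ℤ.+ + 1 ℤ.* y) (1+-as-⊕ (- + 1) k n) (q^*-1+ k (- + 1) k n) ⟩
  𝟙 n ℤ.+ - + 1 ℤ.* qᵏ ℤ.+ + 1 ℤ.* (qᵏ ℤ.+ - + 1 ℤ.* q²ᵏ)
    ≡⟨ telescope (𝟙 n) qᵏ q²ᵏ ⟩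
  𝟙 n ℤ.+ - + 1 ℤ.* q²ᵏ
    ≡⟨ cong (λ j → 𝟙 n ℤ.+ - + 1 ℤ.* (q^ (k ℕ.+ j) * 𝟙) n) (ℕP.+-identityʳ k) ⟨
  𝟙 n ℤ.+ - + 1 ℤ.* (q^ (2 ℕ.* k) * 𝟙) n
    ≡⟨ 1+-as-⊕ (- + 1) (2 ℕ.* k) n ⟨
  (1-q^ (2 ℕ.* k)) n ∎
  where
  open ≡-Reasoning
  qᵏ q²ᵏ : ℤ
  qᵏ  = (q^ k * 𝟙) n
  q²ᵏ = (q^ (k ℕ.+ k) * 𝟙) n
  telescope : ∀ a b c → a ℤ.+ - + 1 ℤ.* b ℤ.+ + 1 ℤ.* (b ℤ.+ - + 1 ℤ.* c) ≡ a ℤ.+ - + 1 ℤ.* c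
  telescope = solve-∀

geo-periodic : ∀ k m → geo k (k ℕ.+ m) ≡ geo k m
geo-periodic k m = cong (if_then + 1 else + 0)
  (⌊⌋-⇔ (mk⇔ (λ k∣k+m → ∣m+n∣m⇒∣n k∣k+m ∣-refl) (∣m∣n⇒∣m+n ∣-refl)) (k ∣? k ℕ.+ m) (k ∣? m))

geo-unfold : ∀ k → geo (suc k) ≗ 𝟙 ⊕ q^ suc k * geo (suc k)
geo-unfold k zero    = refl
geo-unfold k (suc m) with k ℕ.≤? m
... | yes k≤m = begin
  geo (suc k) (suc m)                      ≡⟨ cong (geo (suc k) ∘ suc) (ℕP.m+[n∸m]≡n k≤m) ⟨
  geo (suc k) (suc k ℕ.+ (m ∸ k))          ≡⟨ geo-periodic (suc k) (m ∸ k) ⟩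
  geo (suc k) (m ∸ k)                      ≡⟨ shift-≥ (+ 0) k (geo (suc k)) k≤m ⟨
  (q^ k * geo (suc k)) m                   ≡⟨ ℤP.+-identityˡ _ ⟨
  + 0 ℤ.+ (q^ k * geo (suc k)) m           ∎
  where open ≡-Reasoning
... | no k≰m = begin
  geo (suc k) (suc m)
    ≡⟨ cong (if_then + 1 else + 0) (⌊⌋-false (suc k ∣? suc m) (>⇒∤ (s≤s m<k))) ⟩
  + 0                                      ≡⟨ cong (ℤ._+_ (+ 0)) (shift-< (+ 0) k (geo (suc k)) m<k) ⟨
  + 0 ℤ.+ (q^ k * geo (suc k)) m           ∎
  where
  open ≡-Reasoning
  m<k : m < k
  m<k = ℕP.≰⇒> k≰m

1-q^-⊛-geo : ∀ k → (1-q^ suc k ⊛ geo (suc k)) ≗ 𝟙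
1-q^-⊛-geo k n = begin
  (1-q^ suc k ⊛ geo (suc k)) n        ≡⟨ 1+-⊛ (- + 1) (suc k) (geo (suc k)) n ⟩
  geo (suc k) n ℤ.+ - + 1 ℤ.* qᵏG      ≡⟨ cong (λ x → x ℤ.+ - + 1 ℤ.* qᵏG) (geo-unfold k n) ⟩
  𝟙 n ℤ.+ qᵏG ℤ.+ - + 1 ℤ.* qᵏG        ≡⟨ cancel (𝟙 n) qᵏG ⟩
  𝟙 n                                  ∎
  where
  open ≡-Reasoning
  qᵏG : ℤ
  qᵏG = (q^ suc k * geo (suc k)) n
  cancel : ∀ a b → a ℤ.+ b ℤ.+ - + 1 ℤ.* b ≡ a
  cancel = solve-∀

1+q^≗geo⊛1-q^ : ∀ k → 1+q^ suc k ≗ geo (suc k) ⊛ 1-q^ (2 ℕ.* suc k)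
1+q^≗geo⊛1-q^ k = begin
  1+q^ suc k                                    ≈⟨ ⊛-identityʳ _ ⟨
  1+q^ suc k ⊛ 𝟙                                ≈⟨ ⊛-congˡ (1+q^ suc k) (1-q^-⊛-geo k) ⟨
  1+q^ suc k ⊛ (1-q^ suc k ⊛ geo (suc k))       ≈⟨ ⊛-assoc (1+q^ suc k) (1-q^ suc k) (geo (suc k)) ⟨
  (1+q^ suc k ⊛ 1-q^ suc k) ⊛ geo (suc k)       ≈⟨ ⊛-congʳ (geo (suc k)) (1+q^-⊛-1-q^ (suc k)) ⟩
  1-q^ (2 ℕ.* suc k) ⊛ geo (suc k)              ≈⟨ ⊛-comm (1-q^ (2 ℕ.* suc k)) (geo (suc k)) ⟩
  geo (suc k) ⊛ 1-q^ (2 ℕ.* suc k)              ∎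
  where open ≗-Reasoning

geo-⊛-unfold : ∀ k g → (geo (suc k) ⊛ g) ≗ g ⊕ q^ suc k * (geo (suc k) ⊛ g)
geo-⊛-unfold k g n = begin
  (geo (suc k) ⊛ g) n
    ≡⟨ ⊛-congʳ g (geo-unfold k) n ⟩
  ((𝟙 ⊕ q^ suc k * geo (suc k)) ⊛ g) n
    ≡⟨ ⊛-distribʳ-⊕ 𝟙 (q^ suc k * geo (suc k)) g n ⟩
  (𝟙 ⊛ g) n ℤ.+ ((q^ suc k * geo (suc k)) ⊛ g) n
    ≡⟨ cong₂ ℤ._+_ (⊛-identityˡ g n) (q^*-⊛ (suc k) (geo (suc k)) g n) ⟩
  g n ℤ.+ (q^ suc k * (geo (suc k) ⊛ g)) n ∎
  where open ≡-Reasoning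

-- Truncated products

≈[]-setoid : ℕ → Setoid 0ℓ 0ℓ
≈[]-setoid n = record
  { Carrier = FPS
  ; _≈_ = _≈[ n ]_
  ; isEquivalence = record
    { refl  = λ _ _ → refl
    ; sym   = λ p m m≤n → sym (p m m≤n)
    ; trans = λ p q m m≤n → trans (p m m≤n) (q m m≤n)
    } }

module ≈[]-Reasoning n = SetoidReasoning (≈[]-setoid n)

≗⇒≈[] : ∀ {f g} n → f ≗ g → f ≈[ n ] g
≗⇒≈[] n f≗g m _ = f≗g m

≈[]-mono : ∀ {f g n N} → n ≤ N → f ≈[ N ] g → f ≈[ n ] g
≈[]-mono n≤N f≈g m m≤n = f≈g m (ℕP.≤-trans m≤n n≤N)

prodTo-cong : ∀ {F F′} N → (∀ k → F (suc k) ≗ F′ (suc k)) → prodTo F N ≗ prodTo F′ N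
prodTo-cong zero    F≗F′ _ = refl
prodTo-cong (suc N) F≗F′   = ⊛-cong (prodTo-cong N F≗F′) (F≗F′ N)

prodTo-⊛ : ∀ F F′ N → prodTo (λ k → F k ⊛ F′ k) N ≗ prodTo F N ⊛ prodTo F′ N
prodTo-⊛ F F′ zero    n = sym (⊛-identityˡ 𝟙 n)
prodTo-⊛ F F′ (suc N)   = begin
  prodTo (λ k → F k ⊛ F′ k) N ⊛ (F (suc N) ⊛ F′ (suc N))
    ≈⟨ ⊛-congʳ (F (suc N) ⊛ F′ (suc N)) (prodTo-⊛ F F′ N) ⟩
  (prodTo F N ⊛ prodTo F′ N) ⊛ (F (suc N) ⊛ F′ (suc N))
    ≈⟨ interchange (prodTo F N) (prodTo F′ N) (F (suc N)) (F′ (suc N)) ⟩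
  (prodTo F N ⊛ F (suc N)) ⊛ (prodTo F′ N ⊛ F′ (suc N)) ∎
  where open ≗-Reasoning

OneModQᵏ : (ℕ → FPS) → Set
OneModQᵏ F = ∀ k → F (suc k) ≈[ k ] 𝟙

⊛-≈[]𝟙 : ∀ {f g} n → f ≈[ n ] 𝟙 → g ≈[ n ] 𝟙 → (f ⊛ g) ≈[ n ] 𝟙
⊛-≈[]𝟙 n f≈𝟙 g≈𝟙 m m≤n = trans (⊛-cong-≈[] n f≈𝟙 g≈𝟙 m m≤n) (⊛-identityˡ 𝟙 m)

^-≈[]𝟙 : ∀ {f} n e → f ≈[ n ] 𝟙 → (f ^ e) ≈[ n ] 𝟙
^-≈[]𝟙 n zero    f≈𝟙 _ _ = refl
^-≈[]𝟙 n (suc e) f≈𝟙     = ⊛-≈[]𝟙 n f≈𝟙 (^-≈[]𝟙 n e f≈𝟙)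

OneModQᵏ-^ : ∀ F (e : ℕ → ℕ) → OneModQᵏ F → OneModQᵏ (λ k → F k ^ e k)
OneModQᵏ-^ F e F≈𝟙 k = ^-≈[]𝟙 k (e (suc k)) (F≈𝟙 k)

1+-≈[]𝟙 : ∀ a {j n} → n < j → (1+ a q^ j) ≈[ n ] 𝟙
1+-≈[]𝟙 a {j} n<j m m≤n = begin
  (1+ a q^ j) m                   ≡⟨ 1+-as-⊕ a j m ⟩
  𝟙 m ℤ.+ a ℤ.* (q^ j * 𝟙) m      ≡⟨ cong (λ x → 𝟙 m ℤ.+ a ℤ.* x) (shift-< (+ 0) j 𝟙 (ℕP.≤-<-trans m≤n n<j)) ⟩
  𝟙 m ℤ.+ a ℤ.* + 0               ≡⟨ cong (ℤ._+_ (𝟙 m)) (ℤP.*-zeroʳ a) ⟩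
  𝟙 m ℤ.+ + 0                     ≡⟨ ℤP.+-identityʳ (𝟙 m) ⟩
  𝟙 m                             ∎
  where open ≡-Reasoning

1+-OneModQᵏ : ∀ (a : ℤ) (e : ℕ → ℕ) → (∀ k → k < e (suc k)) → OneModQᵏ (λ k → 1+ a q^ e k)
1+-OneModQᵏ a e k<e k = 1+-≈[]𝟙 a (k<e k)

geo-OneModQᵏ : OneModQᵏ geo
geo-OneModQᵏ k m m≤k = trans (geo-unfold k m)
  (trans (cong (ℤ._+_ (𝟙 m)) (shift-< (+ 0) (suc k) (geo (suc k)) (s≤s m≤k))) (ℤP.+-identityʳ (𝟙 m)))

1-q^-OneModQᵏ : OneModQᵏ 1-q^_
1-q^-OneModQᵏ = 1+-OneModQᵏ (- + 1) (λ k → k) (λ _ → ℕP.≤-refl)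

prodTo-stable : ∀ F → OneModQᵏ F → ∀ {n N} → n ≤ N → prodTo F N ≈[ n ] prodTo F n
prodTo-stable F F≈𝟙 {n} {N} n≤N with ℕP.m≤n⇒m<n∨m≡n n≤N
... | inj₂ refl = λ _ _ → refl
prodTo-stable F F≈𝟙 {n} {suc N} _ | inj₁ (s≤s n≤N) = begin
  prodTo F N ⊛ F (suc N)    ≈⟨ ⊛-cong-≈[] {prodTo F N} n (λ _ _ → refl) (≈[]-mono n≤N (F≈𝟙 N)) ⟩
  prodTo F N ⊛ 𝟙            ≈⟨ ≗⇒≈[] n (⊛-identityʳ (prodTo F N)) ⟩
  prodTo F N                ≈⟨ prodTo-stable F F≈𝟙 n≤N ⟩
  prodTo F n                ∎
  where open ≈[]-Reasoning n

prodInf-≈[] : ∀ F → OneModQᵏ F → ∀ n → prodInf F ≈[ n ] prodTo F n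
prodInf-≈[] F F≈𝟙 n m m≤n = sym (prodTo-stable F F≈𝟙 m≤n m ℕP.≤-refl)

[_∣_] : ℕ → ℕ → ℕ
[ d ∣ n ] = if ⌊ d ∣? n ⌋ then 1 else 0

[∣]-yes : ∀ {d n} → d ∣ n → [ d ∣ n ] ≡ 1
[∣]-yes {d} {n} d∣n = cong (if_then 1 else 0) (⌊⌋-true (d ∣? n) d∣n)

[∣]-no : ∀ {d n} → ¬ d ∣ n → [ d ∣ n ] ≡ 0
[∣]-no {d} {n} d∤n = cong (if_then 1 else 0) (⌊⌋-false (d ∣? n) d∤n)

prodTo-skip : ∀ F a r → (∀ i → i < r → F (suc i ℕ.+ a) ≗ 𝟙) → prodTo F (r ℕ.+ a) ≗ prodTo F a
prodTo-skip F a zero    _    _ = refl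
prodTo-skip F a (suc r) F≗𝟙   = begin
  prodTo F (r ℕ.+ a) ⊛ F (suc r ℕ.+ a)   ≈⟨ ⊛-congˡ (prodTo F (r ℕ.+ a)) (F≗𝟙 r ℕP.≤-refl) ⟩
  prodTo F (r ℕ.+ a) ⊛ 𝟙                 ≈⟨ ⊛-identityʳ _ ⟩
  prodTo F (r ℕ.+ a)                     ≈⟨ prodTo-skip F a r (λ i i<r → F≗𝟙 i (ℕP.m≤n⇒m≤1+n i<r)) ⟩
  prodTo F a                             ∎
  where open ≗-Reasoning

prodTo-multiples : ∀ (A : ℕ → FPS) r N →
  prodTo (λ j → A j ^ [ suc r ∣ j ]) (suc r ℕ.* N) ≗ prodTo (λ k → A (suc r ℕ.* k)) N
prodTo-multiples A r zero rewrite ℕP.*-zeroʳ r = λ _ → refl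
prodTo-multiples A r (suc N) = begin
  prodTo F (m ℕ.* suc N)                   ≡⟨ cong (prodTo F) (ℕP.*-suc m N) ⟩
  prodTo F (r ℕ.+ m ℕ.* N) ⊛ F (m ℕ.+ m ℕ.* N)
    ≈⟨ ⊛-congʳ (F (m ℕ.+ m ℕ.* N)) (prodTo-skip F (m ℕ.* N) r off-multiples) ⟩
  prodTo F (m ℕ.* N) ⊛ F (m ℕ.+ m ℕ.* N)
    ≈⟨ ⊛-cong (prodTo-multiples A r N) on-multiple ⟩
  prodTo (λ k → A (m ℕ.* k)) N ⊛ A (m ℕ.* suc N) ∎
  where
  open ≗-Reasoning
  m : ℕ
  m = suc r
  F : ℕ → FPS
  F j = A j ^ [ m ∣ j ]
  off-multiples : ∀ i → i < r → F (suc i ℕ.+ m ℕ.* N) ≗ 𝟙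
  off-multiples i i<r n = cong (λ e → (A (suc i ℕ.+ m ℕ.* N) ^ e) n)
    ([∣]-no (λ m∣ → >⇒∤ (s≤s i<r) (∣m+n∣m⇒∣n (subst (m ∣_) (ℕP.+-comm (suc i) _) m∣) (m∣m*n N))))
  on-multiple : F (m ℕ.+ m ℕ.* N) ≗ A (m ℕ.* suc N)
  on-multiple n = trans (cong (λ j → F j n) (sym (ℕP.*-suc m N)))
    (trans (cong (λ e → (A (m ℕ.* suc N) ^ e) n) ([∣]-yes (m∣m*n {m} (suc N))))
           (Power.×-homo-1 (A (m ℕ.* suc N)) n))

prodTo-multiples-≈[] : ∀ A → OneModQᵏ A → ∀ r n →
  prodTo (λ k → A (suc r ℕ.* k)) n ≈[ n ] prodTo (λ j → A j ^ [ suc r ∣ j ]) n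
prodTo-multiples-≈[] A A≈𝟙 r n = begin
  prodTo (λ k → A (suc r ℕ.* k)) n
    ≈⟨ ≗⇒≈[] n (prodTo-multiples A r n) ⟨
  prodTo (λ j → A j ^ [ suc r ∣ j ]) (suc r ℕ.* n)
    ≈⟨ prodTo-stable _ (OneModQᵏ-^ A [ suc r ∣_] A≈𝟙) (ℕP.m≤m+n n (r ℕ.* n)) ⟩
  prodTo (λ j → A j ^ [ suc r ∣ j ]) n ∎
  where open ≈[]-Reasoning n

-- Eta quotients

ηQuotient : (ℕ → ℕ) → (ℕ → ℕ) → ℕ → FPS
ηQuotient a b = prodTo (λ j → geo j ^ a j ⊛ (1-q^ j) ^ b j)

ηQuotient-cong : ∀ {a a′ b b′} N → (∀ j → a j ≡ a′ j) → (∀ j → b j ≡ b′ j) →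
                 ηQuotient a b N ≗ ηQuotient a′ b′ N
ηQuotient-cong N a≡a′ b≡b′ = prodTo-cong N λ k n →
  cong₂ (λ x y → (geo (suc k) ^ x ⊛ (1-q^ suc k) ^ y) n) (a≡a′ (suc k)) (b≡b′ (suc k))

ηQuotient-⊛ : ∀ (a b a′ b′ : ℕ → ℕ) N →
  ηQuotient a b N ⊛ ηQuotient a′ b′ N ≗ ηQuotient (λ j → a j ℕ.+ a′ j) (λ j → b j ℕ.+ b′ j) N
ηQuotient-⊛ a b a′ b′ N = begin
  ηQuotient a b N ⊛ ηQuotient a′ b′ N
    ≈⟨ prodTo-⊛ (λ j → geo j ^ a j ⊛ (1-q^ j) ^ b j) (λ j → geo j ^ a′ j ⊛ (1-q^ j) ^ b′ j) N ⟨
  prodTo (λ j → (geo j ^ a j ⊛ (1-q^ j) ^ b j) ⊛ (geo j ^ a′ j ⊛ (1-q^ j) ^ b′ j)) N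
    ≈⟨ prodTo-cong N (λ k → interchange (geo (suc k) ^ a (suc k)) ((1-q^ suc k) ^ b (suc k))
                                        (geo (suc k) ^ a′ (suc k)) ((1-q^ suc k) ^ b′ (suc k))) ⟩
  prodTo (λ j → (geo j ^ a j ⊛ geo j ^ a′ j) ⊛ ((1-q^ j) ^ b j ⊛ (1-q^ j) ^ b′ j)) N
    ≈⟨ prodTo-cong N (λ k → ⊛-cong (Power.×-homo-+ (geo (suc k)) (a (suc k)) (a′ (suc k)))
                                    (Power.×-homo-+ (1-q^ suc k) (b (suc k)) (b′ (suc k)))) ⟨
  ηQuotient (λ j → a j ℕ.+ a′ j) (λ j → b j ℕ.+ b′ j) N ∎
  where open ≗-Reasoning

ηQuotient-cancel : ∀ (c a b : ℕ → ℕ) N →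
  ηQuotient (λ j → c j ℕ.+ a j) (λ j → c j ℕ.+ b j) N ≗ ηQuotient a b N
ηQuotient-cancel c a b N = prodTo-cong N factor
  where
  open ≗-Reasoning
  factor : ∀ k → geo (suc k) ^ (c (suc k) ℕ.+ a (suc k)) ⊛ (1-q^ suc k) ^ (c (suc k) ℕ.+ b (suc k))
                 ≗ geo (suc k) ^ a (suc k) ⊛ (1-q^ suc k) ^ b (suc k)
  factor k = begin
    geo j ^ (c j ℕ.+ a j) ⊛ (1-q^ j) ^ (c j ℕ.+ b j)
      ≈⟨ ⊛-cong (Power.×-homo-+ (geo j) (c j) (a j)) (Power.×-homo-+ (1-q^ j) (c j) (b j)) ⟩
    (geo j ^ c j ⊛ geo j ^ a j) ⊛ ((1-q^ j) ^ c j ⊛ (1-q^ j) ^ b j)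
      ≈⟨ interchange (geo j ^ c j) (geo j ^ a j) ((1-q^ j) ^ c j) ((1-q^ j) ^ b j) ⟩
    (geo j ^ c j ⊛ (1-q^ j) ^ c j) ⊛ (geo j ^ a j ⊛ (1-q^ j) ^ b j)
      ≈⟨ ⊛-congʳ (geo j ^ a j ⊛ (1-q^ j) ^ b j) (Power.×-distrib-+ (geo j) (1-q^ j) (c j)) ⟨
    (geo j ⊛ 1-q^ j) ^ c j ⊛ (geo j ^ a j ⊛ (1-q^ j) ^ b j)
      ≈⟨ ⊛-congʳ (geo j ^ a j ⊛ (1-q^ j) ^ b j) (λ n → trans (Power.×-congʳ (c j) geo⊛1-q^≗𝟙 n) (𝟙^≗𝟙 (c j) n)) ⟩
    𝟙 ⊛ (geo j ^ a j ⊛ (1-q^ j) ^ b j)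
      ≈⟨ ⊛-identityˡ (geo j ^ a j ⊛ (1-q^ j) ^ b j) ⟩
    geo j ^ a j ⊛ (1-q^ j) ^ b j ∎
    where
    j : ℕ
    j = suc k
    geo⊛1-q^≗𝟙 : geo j ⊛ 1-q^ j ≗ 𝟙
    geo⊛1-q^≗𝟙 m = trans (⊛-comm (geo j) (1-q^ j) m) (1-q^-⊛-geo k m)

invQQ≈ηQuotient : ∀ n → invQQ ≈[ n ] ηQuotient (λ _ → 1) (λ _ → 0) n
invQQ≈ηQuotient n = begin
  invQQ        ≈⟨ prodInf-≈[] geo geo-OneModQᵏ n ⟩
  prodTo geo n ≈⟨ ≗⇒≈[] n (prodTo-cong n geo≗geo¹) ⟩
  ηQuotient (λ _ → 1) (λ _ → 0) n ∎
  where
  open ≈[]-Reasoning n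
  geo≗geo¹ : ∀ k → geo (suc k) ≗ geo (suc k) ^ 1 ⊛ 𝟙
  geo≗geo¹ k m = sym (trans (⊛-identityʳ (geo (suc k) ^ 1) m)
                           (Power.×-homo-1 (geo (suc k)) m))

Q4Q4≈ηQuotient : ∀ n → Q4Q4 ≈[ n ] ηQuotient (λ _ → 0) [ 4 ∣_] n
Q4Q4≈ηQuotient n = begin
  Q4Q4                                        ≈⟨ prodInf-≈[] (λ k → 1-q^ (4 ℕ.* k)) oneMod n ⟩
  prodTo (λ k → 1-q^ (4 ℕ.* k)) n             ≈⟨ prodTo-multiples-≈[] 1-q^_ 1-q^-OneModQᵏ 3 n ⟩
  prodTo (λ j → (1-q^ j) ^ [ 4 ∣ j ]) n
    ≈⟨ ≗⇒≈[] n (prodTo-cong n (λ k m → sym (⊛-identityˡ ((1-q^ suc k) ^ [ 4 ∣ suc k ]) m))) ⟩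
  ηQuotient (λ _ → 0) [ 4 ∣_] n               ∎
  where
  open ≈[]-Reasoning n
  oneMod : OneModQᵏ (λ k → 1-q^ (4 ℕ.* k))
  oneMod = 1+-OneModQᵏ (- + 1) (4 ℕ.*_) (λ k → s≤s (ℕP.m≤m+n k _))

negQQ≈ηQuotient : ∀ n → negQQ ≈[ n ] ηQuotient (λ _ → 1) [ 2 ∣_] n
negQQ≈ηQuotient n = begin
  negQQ
    ≈⟨ prodInf-≈[] 1+q^_ (1+-OneModQᵏ (+ 1) (λ k → k) (λ _ → ℕP.≤-refl)) n ⟩
  prodTo 1+q^_ n
    ≈⟨ ≗⇒≈[] n (prodTo-cong n 1+q^≗geo⊛1-q^) ⟩
  prodTo (λ k → geo k ⊛ 1-q^ (2 ℕ.* k)) n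
    ≈⟨ ≗⇒≈[] n (prodTo-⊛ geo (λ k → 1-q^ (2 ℕ.* k)) n) ⟩
  prodTo geo n ⊛ prodTo (λ k → 1-q^ (2 ℕ.* k)) n
    ≈⟨ ⊛-cong-≈[] {prodTo geo n} n (λ _ _ → refl) (prodTo-multiples-≈[] 1-q^_ 1-q^-OneModQᵏ 1 n) ⟩
  prodTo geo n ⊛ prodTo (λ j → (1-q^ j) ^ [ 2 ∣ j ]) n
    ≈⟨ ≗⇒≈[] n (⊛-congʳ (prodTo (λ j → (1-q^ j) ^ [ 2 ∣ j ]) n)
                  (prodTo-cong n (λ k m → sym (Power.×-homo-1 (geo (suc k)) m)))) ⟩
  prodTo (λ j → geo j ^ 1) n ⊛ prodTo (λ j → (1-q^ j) ^ [ 2 ∣ j ]) n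
    ≈⟨ ≗⇒≈[] n (prodTo-⊛ (λ j → geo j ^ 1) (λ j → (1-q^ j) ^ [ 2 ∣ j ]) n) ⟨
  ηQuotient (λ _ → 1) [ 2 ∣_] n ∎
  where open ≈[]-Reasoning n

negQ4Q4≈ηQuotient : ∀ n → negQ4Q4 ≈[ n ] ηQuotient [ 4 ∣_] [ 8 ∣_] n
negQ4Q4≈ηQuotient n = begin
  negQ4Q4
    ≈⟨ prodInf-≈[] (λ k → 1+q^ (4 ℕ.* k)) (1+-OneModQᵏ (+ 1) (4 ℕ.*_) (λ k → s≤s (ℕP.m≤m+n k _))) n ⟩
  prodTo (λ k → 1+q^ (4 ℕ.* k)) n
    ≈⟨ ≗⇒≈[] n (prodTo-cong n factor) ⟩
  prodTo (λ k → geo (4 ℕ.* k) ⊛ 1-q^ (8 ℕ.* k)) n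
    ≈⟨ ≗⇒≈[] n (prodTo-⊛ (λ k → geo (4 ℕ.* k)) (λ k → 1-q^ (8 ℕ.* k)) n) ⟩
  prodTo (λ k → geo (4 ℕ.* k)) n ⊛ prodTo (λ k → 1-q^ (8 ℕ.* k)) n
    ≈⟨ ⊛-cong-≈[] n (prodTo-multiples-≈[] geo geo-OneModQᵏ 3 n)
                    (prodTo-multiples-≈[] 1-q^_ 1-q^-OneModQᵏ 7 n) ⟩
  prodTo (λ j → geo j ^ [ 4 ∣ j ]) n ⊛ prodTo (λ j → (1-q^ j) ^ [ 8 ∣ j ]) n
    ≈⟨ ≗⇒≈[] n (prodTo-⊛ (λ j → geo j ^ [ 4 ∣ j ]) (λ j → (1-q^ j) ^ [ 8 ∣ j ]) n) ⟨
  ηQuotient [ 4 ∣_] [ 8 ∣_] n ∎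
  where
  open ≈[]-Reasoning n
  factor : ∀ k → 1+q^ (4 ℕ.* suc k) ≗ geo (4 ℕ.* suc k) ⊛ 1-q^ (8 ℕ.* suc k)
  factor k m = trans (1+q^≗geo⊛1-q^ (k ℕ.+ 3 ℕ.* suc k) m)
                     (cong (λ j → (geo (4 ℕ.* suc k) ⊛ 1-q^ j) m) (sym (ℕP.*-assoc 2 4 (suc k))))

[∣]-mod : ∀ d n j .{{_ : NonZero n}} → d ∣ n → [ d ∣ j ] ≡ [ d ∣ j % n ]
[∣]-mod d n j d∣n = cong (if_then 1 else 0)
  (⌊⌋-⇔ (mk⇔ (λ d∣j → %-presˡ-∣ d∣j d∣n) (∣n∣m%n⇒∣m d∣n)) (d ∣? j) (d ∣? j % n))

-- Left: the exponent of 1/(1 - qʲ) in h; right: that of 1 - qʲ, plus colours j.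
colours-exponents : ∀ j →
  2 ℕ.+ ([ 4 ∣ j ] ℕ.+ [ 4 ∣ j ]) ≡ [ 2 ∣ j ] ℕ.+ [ 4 ∣ j ] ℕ.+ ([ 8 ∣ j ] ℕ.+ [ 8 ∣ j ]) ℕ.+ colours j
colours-exponents j
  rewrite [∣]-mod 2 8 j (divides 4 refl) | [∣]-mod 4 8 j (divides 2 refl) | [∣]-mod 8 8 j (divides 1 refl)
  with j % 8 | m%n<n j 8
... | 0 | _ = refl
... | 1 | _ = refl
... | 2 | _ = refl
... | 3 | _ = refl
... | 4 | _ = refl
... | 5 | _ = refl
... | 6 | _ = refl
... | 7 | _ = refl
... | suc (suc (suc (suc (suc (suc (suc (suc _))))))) | s≤s (s≤s (s≤s (s≤s (s≤s (s≤s (s≤s (s≤s ())))))))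

ηQuotient-h-factors : ∀ n →
  ηQuotient (λ _ → 1) [ 2 ∣_] n ⊛ ηQuotient (λ _ → 1) (λ _ → 0) n ⊛ ηQuotient (λ _ → 0) [ 4 ∣_] n
    ⊛ (ηQuotient [ 4 ∣_] [ 8 ∣_] n ⊛ ηQuotient [ 4 ∣_] [ 8 ∣_] n)
  ≗ ηQuotient (λ j → 2 ℕ.+ ([ 4 ∣ j ] ℕ.+ [ 4 ∣ j ])) (λ j → [ 2 ∣ j ] ℕ.+ [ 4 ∣ j ] ℕ.+ ([ 8 ∣ j ] ℕ.+ [ 8 ∣ j ])) n
ηQuotient-h-factors n = begin
  ηQuotient (λ _ → 1) [ 2 ∣_] n ⊛ ηQuotient (λ _ → 1) (λ _ → 0) n ⊛ ηQuotient (λ _ → 0) [ 4 ∣_] n ⊛ ηQ₄²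
    ≈⟨ ⊛-congʳ ηQ₄² (⊛-congʳ (ηQuotient (λ _ → 0) [ 4 ∣_] n) (ηQuotient-⊛ (λ _ → 1) [ 2 ∣_] (λ _ → 1) (λ _ → 0) n)) ⟩
  ηQuotient (λ _ → 2) (λ j → [ 2 ∣ j ] ℕ.+ 0) n ⊛ ηQuotient (λ _ → 0) [ 4 ∣_] n ⊛ ηQ₄²
    ≈⟨ ⊛-cong (ηQuotient-⊛ (λ _ → 2) (λ j → [ 2 ∣ j ] ℕ.+ 0) (λ _ → 0) [ 4 ∣_] n)
              (ηQuotient-⊛ [ 4 ∣_] [ 8 ∣_] [ 4 ∣_] [ 8 ∣_] n) ⟩
  ηQuotient (λ _ → 2) b n ⊛ ηQuotient (λ j → [ 4 ∣ j ] ℕ.+ [ 4 ∣ j ]) (λ j → [ 8 ∣ j ] ℕ.+ [ 8 ∣ j ]) n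
    ≈⟨ ηQuotient-⊛ (λ _ → 2) b (λ j → [ 4 ∣ j ] ℕ.+ [ 4 ∣ j ]) (λ j → [ 8 ∣ j ] ℕ.+ [ 8 ∣ j ]) n ⟩
  ηQuotient (λ j → 2 ℕ.+ ([ 4 ∣ j ] ℕ.+ [ 4 ∣ j ])) (λ j → b j ℕ.+ ([ 8 ∣ j ] ℕ.+ [ 8 ∣ j ])) n
    ≈⟨ ηQuotient-cong {a = λ j → 2 ℕ.+ ([ 4 ∣ j ] ℕ.+ [ 4 ∣ j ])} n (λ _ → refl)
                      (λ j → cong (λ x → x ℕ.+ [ 4 ∣ j ] ℕ.+ ([ 8 ∣ j ] ℕ.+ [ 8 ∣ j ])) (ℕP.+-identityʳ [ 2 ∣ j ])) ⟩
  ηQuotient (λ j → 2 ℕ.+ ([ 4 ∣ j ] ℕ.+ [ 4 ∣ j ])) (λ j → [ 2 ∣ j ] ℕ.+ [ 4 ∣ j ] ℕ.+ ([ 8 ∣ j ] ℕ.+ [ 8 ∣ j ])) n ∎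
  where
  open ≗-Reasoning
  ηQ₄² : FPS
  ηQ₄² = ηQuotient [ 4 ∣_] [ 8 ∣_] n ⊛ ηQuotient [ 4 ∣_] [ 8 ∣_] n
  b : ℕ → ℕ
  b j = [ 2 ∣ j ] ℕ.+ 0 ℕ.+ [ 4 ∣ j ]

h≈geo^colours : ∀ n → h ≈[ n ] prodTo (λ j → geo j ^ colours j) n
h≈geo^colours n = begin
  h
    ≈⟨ ⊛-cong-≈[] n (⊛-cong-≈[] n (⊛-cong-≈[] n (negQQ≈ηQuotient n) (invQQ≈ηQuotient n)) (Q4Q4≈ηQuotient n))
                    (⊛-cong-≈[] n (negQ4Q4≈ηQuotient n) (negQ4Q4≈ηQuotient n)) ⟩
  ηQuotient (λ _ → 1) [ 2 ∣_] n ⊛ ηQuotient (λ _ → 1) (λ _ → 0) n ⊛ ηQuotient (λ _ → 0) [ 4 ∣_] n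
    ⊛ (ηQuotient [ 4 ∣_] [ 8 ∣_] n ⊛ ηQuotient [ 4 ∣_] [ 8 ∣_] n)
    ≈⟨ ≗⇒≈[] n (ηQuotient-h-factors n) ⟩
  ηQuotient (λ j → 2 ℕ.+ ([ 4 ∣ j ] ℕ.+ [ 4 ∣ j ])) e n
    ≈⟨ ≗⇒≈[] n (ηQuotient-cong n colours-exponents (λ j → sym (ℕP.+-identityʳ (e j)))) ⟩
  ηQuotient (λ j → e j ℕ.+ colours j) (λ j → e j ℕ.+ 0) n
    ≈⟨ ≗⇒≈[] n (ηQuotient-cancel e colours (λ _ → 0) n) ⟩
  ηQuotient colours (λ _ → 0) n
    ≈⟨ ≗⇒≈[] n (prodTo-cong n (λ k → ⊛-identityʳ (geo (suc k) ^ colours (suc k)))) ⟩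
  prodTo (λ j → geo j ^ colours j) n ∎
  where
  open ≈[]-Reasoning n
  e : ℕ → ℕ
  e j = [ 2 ∣ j ] ℕ.+ [ 4 ∣ j ] ℕ.+ ([ 8 ∣ j ] ℕ.+ [ 8 ∣ j ])

-- Partitions over a sorted list of parts

ColPart : Set
ColPart = ℕ × ℕ

_≻_ : ColPart → ColPart → Set
(a , c) ≻ (b , d) = (b < a) ⊎ (b ≡ a × d < c)

⊒-refl : ∀ {x} → x ⊒ x
⊒-refl = inj₂ (refl , ℕP.≤-refl)

⊒-trans : ∀ {x y z} → x ⊒ y → y ⊒ z → x ⊒ z
⊒-trans x⊒y y⊒z =
  ×-transitive {_<₁_ = _<_} {_<₂_ = _≤_} isEquivalence (resp₂ _<_) ℕP.<-trans ℕP.≤-trans y⊒z x⊒y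

≻⇒⊒ : ∀ {x y} → x ≻ y → x ⊒ y
≻⇒⊒ (inj₁ b<a)         = inj₁ b<a
≻⇒⊒ (inj₂ (b≡a , d<c)) = inj₂ (b≡a , ℕP.<⇒≤ d<c)

≻⇒⋣ : ∀ {x y} → x ≻ y → ¬ y ⊒ x
≻⇒⋣ (inj₁ b<a)          (inj₁ a<b)          = ℕP.<-asym b<a a<b
≻⇒⋣ (inj₁ b<a)          (inj₂ (refl , _))   = ℕP.<-irrefl refl b<a
≻⇒⋣ (inj₂ (refl , _))   (inj₁ a<a)          = ℕP.<-irrefl refl a<a
≻⇒⋣ (inj₂ (refl , d<c)) (inj₂ (_ , c≤d))    = ℕP.<⇒≱ d<c c≤d

Positive : List ColPart → Set
Positive = All (λ t → 1 ≤ proj₁ t)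

Sorted : List ColPart → Set
Sorted = AllPairs _≻_

geoProduct : List ColPart → FPS
geoProduct = foldr (λ t g → geo (proj₁ t) ⊛ g) 𝟙

IsPartitionOver : List ColPart → ℕ → List ColPart → Set
IsPartitionOver T n p = All (_∈ T) p × Linked _⊒_ p × sum (map proj₁ p) ≡ n

-- For T strictly decreasing: the partitions of n into parts from T that avoid the head t of T,
-- followed by those whose largest part is t. The fuel f is spent once per part, so n ≤ f
-- suffices when all parts are positive.
mutual
  partitions : ℕ → List ColPart → ℕ → List (List ColPart)
  partitions f []      zero    = [] ∷ []
  partitions f []      (suc n) = []
  partitions f (t ∷ T) n       = partitions f T n ++ shift [] (proj₁ t) (startingWith f t T) n

  startingWith : ℕ → ColPart → List ColPart → ℕ → List (List ColPart)
  startingWith zero    t T m = []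
  startingWith (suc f) t T m = map (t ∷_) (partitions f (t ∷ T) m)

partitions-count : ∀ f T → Positive T → ∀ n → n ≤ f → geoProduct T n ≡ + length (partitions f T n)
partitions-count f []      _ zero    _ = refl
partitions-count f []      _ (suc n) _ = refl
partitions-count f ((suc s , c) ∷ T) (_ ∷ T⁺) n n≤f = begin
  (geo (suc s) ⊛ geoProduct T) n                                   ≡⟨ geo-⊛-unfold s (geoProduct T) n ⟩
  geoProduct T n ℤ.+ (q^ suc s * geoProduct ((suc s , c) ∷ T)) n
    ≡⟨ cong₂ ℤ._+_ (partitions-count f T T⁺ n n≤f) (shift-cong (+ 0) (suc s) (counts-after-first f n≤f)) ⟩
  + length (partitions f T n) ℤ.+ (q^ suc s * (+_ ∘ length ∘ startingWith f t T)) n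
    ≡⟨ cong (ℤ._+_ (+ length (partitions f T n))) (shift-map (+_ ∘ length) [] (suc s) (startingWith f t T) n) ⟨
  + length (partitions f T n) ℤ.+ + length (shift [] (suc s) (startingWith f t T) n)
    ≡⟨ cong +_ (length-++ (partitions f T n)) ⟨
  + length (partitions f (t ∷ T) n) ∎
  where
  open ≡-Reasoning
  t : ColPart
  t = (suc s , c)
  counts-after-first : ∀ f {n} → n ≤ f → ∀ m → suc s ℕ.+ m ≡ n →
                       geoProduct (t ∷ T) m ≡ + length (startingWith f t T m)
  counts-after-first zero    n≤0     m refl with () ← n≤0
  counts-after-first (suc f) n≤1+f   m refl = begin
    geoProduct (t ∷ T) m                              ≡⟨ partitions-count f (t ∷ T) (s≤s z≤n ∷ T⁺) m m≤f ⟩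
    + length (partitions f (t ∷ T) m)                 ≡⟨ cong +_ (length-map (t ∷_) (partitions f (t ∷ T) m)) ⟨
    + length (map (t ∷_) (partitions f (t ∷ T) m))    ∎
    where
    m≤f : m ≤ f
    m≤f = ℕP.≤-trans (ℕP.m≤n+m m s) (ℕP.≤-pred n≤1+f)

cons-Linked : ∀ {t T p} → All (t ≻_) T → All (_∈ t ∷ T) p → Linked _⊒_ p → Linked _⊒_ (t ∷ p)
cons-Linked t≻T []                  _ = [-]
cons-Linked t≻T (here refl   ∷ _) p↓ = ⊒-refl ∷ p↓
cons-Linked t≻T (there x∈T   ∷ _) p↓ = ≻⇒⊒ (All.lookup t≻T x∈T) ∷ p↓

partitions-sound : ∀ f T n p → Sorted T → p ∈ partitions f T n → IsPartitionOver T n p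
partitions-sound f []      zero    p _ (here refl) = [] , [] , refl
partitions-sound f (t ∷ T) n       p (t≻T ∷ T↓) p∈ with ∈-++⁻ (partitions f T n) p∈
... | inj₁ p∈ᵀ with p⊆T , p↓ , Σp ← partitions-sound f T n p T↓ p∈ᵀ = All.map there p⊆T , p↓ , Σp
... | inj₂ p∈ᵗ with m , |t|+m≡n , p∈′ ← ∈-shift⁻ {k = proj₁ t} p∈ᵗ = first-part f p∈′
  where
  first-part : ∀ f → p ∈ startingWith f t T m → IsPartitionOver (t ∷ T) n p
  first-part (suc f) p∈″ with p′ , p′∈ , refl ← ∈-map⁻ (t ∷_) p∈″
                        with p′⊆ , p′↓ , Σp′ ← partitions-sound f (t ∷ T) m p′ (t≻T ∷ T↓) p′∈ =
    here refl ∷ p′⊆ , cons-Linked t≻T p′⊆ p′↓ , trans (cong (proj₁ t ℕ.+_) Σp′) |t|+m≡n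

∈-tail : ∀ {A : Set} {x t : A} {T} → x ∈ t ∷ T → x ≢ t → x ∈ T
∈-tail (here x≡t) x≢t = ⊥-elim (x≢t x≡t)
∈-tail (there x∈T) _  = x∈T

Linked-tail : ∀ {x p} → Linked _⊒_ (x ∷ p) → Linked _⊒_ p
Linked-tail [-]       = []
Linked-tail (_ ∷ p↓) = p↓

⊆-tail-below : ∀ {t T x p} → All (t ≻_) T → ¬ x ⊒ t → All (_∈ t ∷ T) p → All (x ⊒_) p → All (_∈ T) p
⊆-tail-below t≻T x⋣t []                  []          = []
⊆-tail-below t≻T x⋣t (here refl ∷ p⊆)  (x⊒t ∷ _)   = ⊥-elim (x⋣t x⊒t)
⊆-tail-below t≻T x⋣t (there y∈T ∷ p⊆)  (_ ∷ x⊒p)   = y∈T ∷ ⊆-tail-below t≻T x⋣t p⊆ x⊒p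

partitions-complete : ∀ f T n p → n ≤ f → Sorted T → Positive T → IsPartitionOver T n p →
                      p ∈ partitions f T n
partitions-complete f []      n []      _   _ _ (_ , _ , refl) = here refl
partitions-complete f []      n (x ∷ p) _   _ _ (() ∷ _ , _)
partitions-complete f (t ∷ T) n []      n≤f (_ ∷ T↓) (_ ∷ T⁺) (_ , _ , Σp) =
  ∈-++⁺ˡ (partitions-complete f T n [] n≤f T↓ T⁺ ([] , [] , Σp))
partitions-complete f (t ∷ T) n (x ∷ p) n≤f (t≻T ∷ T↓) (t⁺ ∷ T⁺) (x∈ ∷ p⊆ , xp↓ , Σxp)
  with ×P.≡-dec ℕ._≟_ ℕ._≟_ x t
... | yes refl = ∈-++⁺ʳ (partitions f T n) (subst (λ n → x ∷ p ∈ shift [] (proj₁ x) (startingWith f x T) n) Σxp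
                                                (∈-shift⁺ {k = proj₁ x} (first-part f n≤f)))
  where
  first-part : ∀ f → n ≤ f → x ∷ p ∈ startingWith f x T (sum (map proj₁ p))
  first-part zero    n≤0   with () ← ℕP.≤-trans (ℕP.≤-trans t⁺ (ℕP.m≤m+n (proj₁ x) _)) (subst (_≤ 0) (sym Σxp) n≤0)
  first-part (suc f) n≤1+f = ∈-map⁺ (x ∷_)
    (partitions-complete f (x ∷ T) _ p Σp≤f (t≻T ∷ T↓) (t⁺ ∷ T⁺) (p⊆ , Linked-tail xp↓ , refl))
    where
    Σp≤f : sum (map proj₁ p) ≤ f
    Σp≤f = ℕP.≤-pred (ℕP.≤-trans (ℕP.+-monoˡ-≤ _ t⁺) (subst (_≤ suc f) (sym Σxp) n≤1+f))
... | no x≢t = ∈-++⁺ˡ (partitions-complete f T n (x ∷ p) n≤f T↓ T⁺ (xp⊆T , xp↓ , Σxp))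
  where
  x∈T : x ∈ T
  x∈T = ∈-tail x∈ x≢t
  x⋣t : ¬ x ⊒ t
  x⋣t = ≻⇒⋣ (All.lookup t≻T x∈T)
  xp⊆T : All (_∈ T) (x ∷ p)
  xp⊆T = ⊆-tail-below t≻T x⋣t (x∈ ∷ p⊆) (Linked⇒All ⊒-trans ⊒-refl xp↓)

∈-partitions⇔ : ∀ f T n p → n ≤ f → Sorted T → Positive T → p ∈ partitions f T n ⇔ IsPartitionOver T n p
∈-partitions⇔ f T n p n≤f T↓ T⁺ = mk⇔ (partitions-sound f T n p T↓) (partitions-complete f T n p n≤f T↓ T⁺)

∈-startingWith⇒∋ : ∀ f {t T m p} → p ∈ startingWith f t T m → t ∈ p
∈-startingWith⇒∋ (suc f) {t} p∈ with _ , _ , refl ← ∈-map⁻ (t ∷_) p∈ = here refl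

mutual
  partitions-unique : ∀ f T n → Sorted T → Unique (partitions f T n)
  partitions-unique f []      zero    _ = [] ∷ []
  partitions-unique f []      (suc n) _ = []
  partitions-unique f (t ∷ T) n (t≻T ∷ T↓) = Unique.++⁺ (partitions-unique f T n T↓)
    (shift-Unique (proj₁ t) (startingWith f t T) n (λ m → startingWith-unique f t T m (t≻T ∷ T↓))) disjoint
    where
    disjoint : ∀ {p} → ¬ (p ∈ partitions f T n × p ∈ shift [] (proj₁ t) (startingWith f t T) n)
    disjoint (p∈ᵀ , p∈ᵗ) with _ , _ , p∈′ ← ∈-shift⁻ {k = proj₁ t} p∈ᵗ =
      ≻⇒⋣ (All.lookup t≻T (All.lookup (proj₁ (partitions-sound f T n _ T↓ p∈ᵀ)) (∈-startingWith⇒∋ f p∈′))) ⊒-refl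

  startingWith-unique : ∀ f t T m → Sorted (t ∷ T) → Unique (startingWith f t T m)
  startingWith-unique zero    t T m _  = []
  startingWith-unique (suc f) t T m T↓ = Unique.map⁺ (λ { refl → refl }) (partitions-unique f (t ∷ T) m T↓)

-- Coloured partitions

IsColouredPart : ColPart → Set
IsColouredPart (k , c) = 1 ≤ k × c < colours k

colouredParts : ℕ → List ColPart
colouredParts zero    = []
colouredParts (suc k) = applyDownFrom (suc k ,_) (colours (suc k)) ++ colouredParts k

∈-colouredParts⁻ : ∀ {N x} → x ∈ colouredParts N → IsColouredPart x × proj₁ x ≤ N
∈-colouredParts⁻ {suc k} x∈ with ∈-++⁻ (applyDownFrom (suc k ,_) (colours (suc k))) x∈
... | inj₁ x∈ᵏ with c , c<colours , refl ← ∈-applyDownFrom⁻ (suc k ,_) x∈ᵏ = (s≤s z≤n , c<colours) , ℕP.≤-refl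
... | inj₂ x∈′ with x-ok , x≤k ← ∈-colouredParts⁻ {k} x∈′ = x-ok , ℕP.m≤n⇒m≤1+n x≤k

∈-colouredParts⁺ : ∀ {N k c} → IsColouredPart (k , c) → k ≤ N → (k , c) ∈ colouredParts N
∈-colouredParts⁺ {suc N} {k} {c} k,c-ok k≤1+N with ℕP.m≤n⇒m<n∨m≡n k≤1+N
... | inj₂ refl       = ∈-++⁺ˡ (∈-applyDownFrom⁺ (k ,_) (proj₂ k,c-ok))
... | inj₁ (s≤s k≤N) = ∈-++⁺ʳ (applyDownFrom (suc N ,_) (colours (suc N))) (∈-colouredParts⁺ k,c-ok k≤N)
∈-colouredParts⁺ {zero} (1≤k , _) k≤0 with () ← ℕP.≤-trans 1≤k k≤0

colouredParts-sorted : ∀ N → Sorted (colouredParts N)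
colouredParts-sorted zero    = []
colouredParts-sorted (suc k) = AllPairs.++⁺
  (AllPairs.applyDownFrom⁺₁ (suc k ,_) (colours (suc k)) (λ d<c _ → inj₂ (refl , d<c)))
  (colouredParts-sorted k)
  (All.tabulate λ x∈ᵏ → All.tabulate λ y∈ → above (∈-applyDownFrom⁻ (suc k ,_) x∈ᵏ) (∈-colouredParts⁻ {k} y∈))
  where
  above : ∀ {x y} → ∃[ c ] (c < colours (suc k) × x ≡ (suc k , c)) → IsColouredPart y × proj₁ y ≤ k → x ≻ y
  above (_ , _ , refl) (_ , y≤k) = inj₁ (s≤s y≤k)

colouredParts-positive : ∀ N → Positive (colouredParts N)
colouredParts-positive N = All.tabulate λ x∈ → proj₁ (proj₁ (∈-colouredParts⁻ {N} x∈))

geoProduct-++ : ∀ A B → geoProduct (A ++ B) ≗ geoProduct A ⊛ geoProduct B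
geoProduct-++ []      B n = sym (⊛-identityˡ (geoProduct B) n)
geoProduct-++ ((k , _) ∷ A) B n = begin
  (geo k ⊛ geoProduct (A ++ B)) n               ≡⟨ ⊛-congˡ (geo k) (geoProduct-++ A B) n ⟩
  (geo k ⊛ (geoProduct A ⊛ geoProduct B)) n     ≡⟨ ⊛-assoc (geo k) (geoProduct A) (geoProduct B) n ⟨
  (geo k ⊛ geoProduct A ⊛ geoProduct B) n       ∎
  where open ≡-Reasoning

geoProduct-colours : ∀ k c → geoProduct (applyDownFrom (k ,_) c) ≗ geo k ^ c
geoProduct-colours k zero    _ = refl
geoProduct-colours k (suc c)   = ⊛-congˡ (geo k) (geoProduct-colours k c)

geoProduct-colouredParts : ∀ N → geoProduct (colouredParts N) ≗ prodTo (λ j → geo j ^ colours j) N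
geoProduct-colouredParts zero    _ = refl
geoProduct-colouredParts (suc k) = begin
  geoProduct (applyDownFrom (suc k ,_) (colours (suc k)) ++ colouredParts k)
    ≈⟨ geoProduct-++ (applyDownFrom (suc k ,_) (colours (suc k))) (colouredParts k) ⟩
  geoProduct (applyDownFrom (suc k ,_) (colours (suc k))) ⊛ geoProduct (colouredParts k)
    ≈⟨ ⊛-cong (geoProduct-colours (suc k) (colours (suc k))) (geoProduct-colouredParts k) ⟩
  geo (suc k) ^ colours (suc k) ⊛ prodTo (λ j → geo j ^ colours j) k
    ≈⟨ ⊛-comm (geo (suc k) ^ colours (suc k)) (prodTo (λ j → geo j ^ colours j) k) ⟩
  prodTo (λ j → geo j ^ colours j) k ⊛ geo (suc k) ^ colours (suc k) ∎
  where open ≗-Reasoning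

part≤sum : ∀ (p : List ColPart) → All (λ x → proj₁ x ≤ sum (map proj₁ p)) p
part≤sum []      = []
part≤sum (x ∷ p) = ℕP.m≤m+n (proj₁ x) _ ∷ All.map (λ y≤Σp → ℕP.≤-trans y≤Σp (ℕP.m≤n+m _ (proj₁ x))) (part≤sum p)

IsPartitionOver⇔IsColPartition : ∀ n p → IsPartitionOver (colouredParts n) n p ⇔ IsColPartition n p
IsPartitionOver⇔IsColPartition n p = mk⇔
  (λ { (p⊆ , p↓ , Σp) → All.map (λ x∈ → proj₁ (∈-colouredParts⁻ {n} x∈)) p⊆ , p↓ , Σp })
  (λ { (p-ok , p↓ , Σp) → All.zipWith (uncurry ∈-colouredParts⁺)
                            (p-ok , subst (λ s → All (λ (x : ColPart) → proj₁ x ≤ s) p) Σp (part≤sum p)) , p↓ , Σp })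

theorem3 : (n : ℕ) → ∃[ L ] (Unique L
    × (∀ p → (p ∈ L) ⇔ IsColPartition n p)
    × h n ≡ + length L)
theorem3 n = L , partitions-unique n (colouredParts n) n (colouredParts-sorted n) , membership , count
  where
  L : List (List ColPart)
  L = partitions n (colouredParts n) n
  membership : ∀ p → (p ∈ L) ⇔ IsColPartition n p
  membership p = IsPartitionOver⇔IsColPartition n p ⇔-∘
    ∈-partitions⇔ n (colouredParts n) n p ℕP.≤-refl (colouredParts-sorted n) (colouredParts-positive n)
  count : h n ≡ + length L
  count = begin
    h n                                         ≡⟨ h≈geo^colours n n ℕP.≤-refl ⟩
    prodTo (λ j → geo j ^ colours j) n n        ≡⟨ geoProduct-colouredParts n n ⟨
    geoProduct (colouredParts n) n
      ≡⟨ partitions-count n (colouredParts n) (colouredParts-positive n) n ℕP.≤-refl ⟩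
    + length L                                  ∎
    where open ≡-Reasoning
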